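{- There is an absolute constant $c>0$ such that for every prime power $q$ and every $P\subset\mathbb{F}_q^2$ with $|P|\geq 4q$, the number of collinear triples in $P$ is at least $c\,\frac{|P|^3}{q}$.
   Context: $\mathbb{F}_q$ is the finite field with $q$ elements. A collinear triple in $P$ is a set of three distinct points of $P$ lying on a common affine line of $\mathbb{F}_q^2$. -}

module Defs where

open import Level using (Level; _⊔_; suc)
open import Algebra.Bundles using (CommutativeRing)
open import Data.Nat using (ℕ; zero; _<_) renaming (_+_ to _+ℕ_)
open import Data.List using (List; length; lookup)
open import Data.List.Relation.Unary.Any using (Any)
open import Data.List.Relation.Unary.AllPairs using (AllPairs)
open import Data.Fin using (Fin)
open import Data.Fin.Properties using (_<?_)
open import Data.Product using (Σ; _×_; _,_)
open import Relation.Nullary using (¬_; Dec; yes; no)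
open import Relation.Binary using (Rel)

record IsFieldCR {c ℓ : Level} (R : CommutativeRing c ℓ) : Set (c ⊔ ℓ) where
  open CommutativeRing R
  field
    1≉0     : ¬ (1# ≈ 0#)
    inverse : ∀ x → ¬ (x ≈ 0#) → Σ Carrier λ y → (x * y) ≈ 1#

record FiniteField (c ℓ : Level) : Set (suc (c ⊔ ℓ)) where
  field
    cring    : CommutativeRing c ℓ
    isField  : IsFieldCR cring
  open CommutativeRing cring public
  field
    _≟_      : ∀ x y → Dec (x ≈ y)
    elems    : List Carrier
    complete : ∀ x → Any (x ≈_) elems
    distinct : AllPairs (λ x y → ¬ (x ≈ y)) elems

  order : ℕ
  order = length elems

  Point : Set c
  Point = Carrier × Carrier

  _≈ₚ_ : Point → Point → Set ℓ
  (x , y) ≈ₚ (x' , y') = (x ≈ x') × (y ≈ y')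

  OnLine : Carrier → Carrier → Carrier → Point → Set ℓ
  OnLine a b d (x , y) = ((a * x) + (b * y)) ≈ d

  Collinear : Point → Point → Point → Set (c ⊔ ℓ)
  Collinear p p' p'' =
    Σ Carrier λ a → Σ Carrier λ b → Σ Carrier λ d →
      ¬ ((a ≈ 0#) × (b ≈ 0#)) × OnLine a b d p × OnLine a b d p' × OnLine a b d p''

  DistinctPoints : List Point → Set (c ⊔ ℓ)
  DistinctPoints P = AllPairs (λ p p' → ¬ (p ≈ₚ p')) P

countFin : ∀ {n} → (Fin n → ℕ) → ℕ
countFin {zero}  f = 0
countFin {ℕ.suc n} f = f Fin.zero +ℕ countFin (λ i → f (Fin.suc i))

module _ {c ℓ} (F : FiniteField c ℓ) where
  open FiniteField F

  -- Number of collinear triples of P: the number of index triples i < j < k of the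
  -- (duplicate-free) list P whose points are collinear, i.e. the number of
  -- 3-element subsets of P lying on a common line.  The decision procedure
  -- `dec` only affects how the count is computed, not its value.
  collinearTriples : (P : List Point) →
    (dec : ∀ p p' p'' → Dec (Collinear p p' p'')) → ℕ
  collinearTriples P dec =
    countFin λ i → countFin λ j → countFin λ k → ind i j k
    where
    ind : Fin (length P) → Fin (length P) → Fin (length P) → ℕ
    ind i j k with i <? j | j <? k | dec (lookup P i) (lookup P j) (lookup P k)
    ... | yes _ | yes _ | yes _ = 1
    ... | _     | _     | _     = 0

-- For each index i, sort the points p_j with j > i into the q + 1 lines through p_i by their
-- direction.  If a_i is the number of such j and n_t are the class sizes, Cauchy–Schwarz gives
-- a_i² ≤ (q + 1) Σ_t n_t² = (q + 1) (a_i + 2 m_i), where m_i counts the pairs j < k lying in a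
-- common class; every such pair is a collinear triple i < j < k.  Summing over i yields
-- Σ a_i² ≤ (q + 1) (Σ a_i + 2 T) for the number T of collinear triples, and as Σ a_i² ≈ N³/3,
-- Σ a_i ≈ N²/2 and N ≥ 4q ≥ 8, this forces N³ ≤ 48 q T.

module Submission where

open import Defs
open import Level using (Level; 0ℓ)
open import Data.Nat using (ℕ; suc)
open import Data.List using (List; []; _∷_; length; lookup)
open import Data.List.Relation.Unary.Any using (Any; here; index)
open import Data.List.Relation.Unary.Any.Properties using (lookup-index)
open import Data.Fin using (Fin; zero; suc)
open import Data.Product using (Σ; _×_; _,_; proj₁; proj₂)
open import Function using (_∘_)
open import Relation.Nullary using (¬_; Dec; does; yes; no; contradiction)
open import Relation.Binary.PropositionalEquality using (_≡_; subst)
import Algebra.Properties.Ring as RingProperties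
import Algebra.Properties.CommutativeSemigroup as CommutativeSemigroupProperties
import Relation.Binary.Reasoning.Setoid as SetoidReasoning

module Directions {c ℓ} (F : FiniteField c ℓ) where
  open FiniteField F hiding (zero)
  open IsFieldCR isField
  open RingProperties ring using (-1*x≈-x; x∙y⁻¹≈ε⇒x≈y; x[y-z]≈xy-xz; -‿+-comm; -‿involutive; -0#≈0#)
  open CommutativeSemigroupProperties +-commutativeSemigroup using (interchange)
  open SetoidReasoning setoid

  OnDirection : Point → Fin (suc order) → Point → Set ℓ
  OnDirection (x₀ , y₀) zero    (x , y) = x - x₀ ≈ 0#
  OnDirection (x₀ , y₀) (suc t) (x , y) = y - y₀ ≈ lookup elems t * (x - x₀)

  direction : Point → Point → Fin (suc order)
  direction (x₀ , y₀) (x , y) with (x - x₀) ≟ 0#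
  ... | yes _   = zero
  ... | no dx≉0 = suc (index (complete ((y - y₀) * proj₁ (inverse (x - x₀) dx≉0))))

  onDirection : ∀ p u → OnDirection p (direction p u) u
  onDirection (x₀ , y₀) (x , y) with (x - x₀) ≟ 0#
  ... | yes dx≈0 = dx≈0
  ... | no dx≉0  = begin
    dy                    ≈⟨ *-identityʳ dy ⟨
    dy * 1#               ≈⟨ *-congˡ (proj₂ (inverse dx dx≉0)) ⟨
    dy * (dx * dx⁻¹)      ≈⟨ *-congˡ (*-comm dx dx⁻¹) ⟩
    dy * (dx⁻¹ * dx)      ≈⟨ *-assoc dy dx⁻¹ dx ⟨
    (dy * dx⁻¹) * dx      ≈⟨ *-congʳ (lookup-index (complete (dy * dx⁻¹))) ⟩
    lookup elems (index (complete (dy * dx⁻¹))) * dx ∎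
    where
    dx = x - x₀
    dy = y - y₀
    dx⁻¹ = proj₁ (inverse dx dx≉0)

  onDirection-self : ∀ p d → OnDirection p d p
  onDirection-self (x₀ , y₀) zero    = -‿inverseʳ x₀
  onDirection-self (x₀ , y₀) (suc t) = begin
    y₀ - y₀                ≈⟨ -‿inverseʳ y₀ ⟩
    0#                     ≈⟨ zeroʳ s ⟨
    s * 0#                 ≈⟨ *-congˡ (-‿inverseʳ x₀) ⟨
    s * (x₀ - x₀)          ∎
    where s = lookup elems t

  -1≉0 : ¬ (- 1# ≈ 0#)
  -1≉0 -1≈0 = 1≉0 (begin
    1#       ≈⟨ -‿involutive 1# ⟨
    - (- 1#) ≈⟨ -‿cong -1≈0 ⟩
    - 0#     ≈⟨ -0#≈0# ⟩
    0#       ∎)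

  [a-b]-[c-d]≈[a-c]-[b-d] : ∀ a b c d → (a - b) - (c - d) ≈ (a - c) - (b - d)
  [a-b]-[c-d]≈[a-c]-[b-d] a b c d = begin
    (a - b) + - (c - d)   ≈⟨ +-congˡ (-‿+-comm c (- d)) ⟨
    (a - b) + (- c - - d) ≈⟨ interchange a (- b) (- c) (- - d) ⟩
    (a - c) + (- b - - d) ≈⟨ +-congˡ (-‿+-comm b (- d)) ⟩
    (a - c) - (b - d)     ∎

  directionLine : ∀ p d → Σ Carrier λ a → Σ Carrier λ b → Σ Carrier λ e →
    ¬ ((a ≈ 0#) × (b ≈ 0#)) × (∀ u → OnDirection p d u → OnLine a b e u)
  directionLine (x₀ , y₀) zero = 1# , 0# , x₀ , 1≉0 ∘ proj₁ , onVertical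
    where
    onVertical : ∀ u → OnDirection (x₀ , y₀) zero u → OnLine 1# 0# x₀ u
    onVertical (x , y) dx≈0 = begin
      1# * x + 0# * y ≈⟨ +-cong (*-identityˡ x) (zeroˡ y) ⟩
      x + 0#          ≈⟨ +-identityʳ x ⟩
      x               ≈⟨ x∙y⁻¹≈ε⇒x≈y x x₀ dx≈0 ⟩
      x₀              ∎
  directionLine (x₀ , y₀) (suc t) = s , - 1# , s * x₀ - y₀ , -1≉0 ∘ proj₂ , onSlope
    where
    s = lookup elems t
    onSlope : ∀ u → OnDirection (x₀ , y₀) (suc t) u → OnLine s (- 1#) (s * x₀ - y₀) u
    onSlope (x , y) dy≈s*dx = x∙y⁻¹≈ε⇒x≈y _ _ (begin
      (s * x + - 1# * y) - (s * x₀ - y₀) ≈⟨ +-congʳ (+-congˡ (-1*x≈-x y)) ⟩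
      (s * x - y) - (s * x₀ - y₀)        ≈⟨ [a-b]-[c-d]≈[a-c]-[b-d] (s * x) y (s * x₀) y₀ ⟩
      (s * x - s * x₀) - (y - y₀)        ≈⟨ +-congʳ (x[y-z]≈xy-xz s x x₀) ⟨
      s * (x - x₀) - (y - y₀)            ≈⟨ +-congʳ dy≈s*dx ⟨
      (y - y₀) - (y - y₀)                ≈⟨ -‿inverseʳ (y - y₀) ⟩
      0#                                 ∎)

  sameDirection⇒collinear : ∀ p u v → direction p u ≡ direction p v → Collinear p u v
  sameDirection⇒collinear p u v eq with directionLine p (direction p v)
  ... | a , b , e , nondegenerate , onLine =
    a , b , e , nondegenerate , onLine p (onDirection-self p (direction p v)) ,
    onLine u (subst (λ d → OnDirection p d u) eq (onDirection p u)) , onLine v (onDirection p v)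

-- The arithmetic of ℕ is opened only here, where the field operations are out of scope.
open import Data.Nat using (zero; _≤_; _+_; _*_; _^_; z≤n; s≤s)
open import Data.Nat.Properties
  using ( +-*-semiring; +-identityʳ; *-identityˡ; *-identityʳ; *-zeroʳ; *-assoc; +-comm; *-comm
        ; ≤-refl; ≤-trans; ≤-total; m≤m+n; m≤n⇒∃[o]m+o≡n; +-mono-≤; +-monoˡ-≤; +-monoʳ-≤
        ; *-monoˡ-≤; *-monoʳ-≤; +-cancelʳ-≤; *-cancelˡ-≤; module ≤-Reasoning )
open import Data.Nat.Tactic.RingSolver using (solve-∀)
open import Data.Bool using (Bool; true; false; _∧_)
open import Data.Fin.Properties using (_≟_; _<?_)
open import Data.Sum using (inj₁; inj₂)
open import Relation.Nullary.Decidable using (dec-true; isYes; isYes≗does)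
open import Relation.Binary.PropositionalEquality using (refl; sym; trans; cong; cong₂; subst₂; module ≡-Reasoning)
open import Algebra.Properties.Semiring.Sum +-*-semiring
  using (sum; sum-syntax; sum-cong-≗; sum-replicate-zero; ∑-distrib-+; ∑-comm; *-distribˡ-sum; *-distribʳ-sum)

𝟙 : Bool → ℕ
𝟙 true  = 1
𝟙 false = 0

countFin≡sum : ∀ {n} (f : Fin n → ℕ) → countFin f ≡ sum f
countFin≡sum {zero}  f = refl
countFin≡sum {suc n} f = cong (f zero +_) (countFin≡sum (f ∘ suc))

∑-mono-≤ : ∀ {n} {f g : Fin n → ℕ} → (∀ i → f i ≤ g i) → sum f ≤ sum g
∑-mono-≤ {zero}  f≤g = z≤n
∑-mono-≤ {suc n} f≤g = +-mono-≤ (f≤g zero) (∑-mono-≤ (f≤g ∘ suc))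

∑-const : ∀ n c → ∑[ i < n ] c ≡ n * c
∑-const zero    c = refl
∑-const (suc n) c = cong (c +_) (∑-const n c)

∑-δ : ∀ {m} (s : Fin m) (g : Fin m → ℕ) → ∑[ t < m ] (𝟙 (does (s ≟ t)) * g t) ≡ g s
∑-δ {suc m} zero    g = trans (cong₂ _+_ (+-identityʳ (g zero)) (sum-replicate-zero m)) (+-identityʳ (g zero))
∑-δ {suc m} (suc s) g = ∑-δ s (g ∘ suc)

∑*∑ : ∀ {m n} (f : Fin m → ℕ) (g : Fin n → ℕ) → sum f * sum g ≡ ∑[ i < m ] ∑[ j < n ] (f i * g j)
∑*∑ f g = trans (*-distribʳ-sum (sum g) f) (sum-cong-≗ λ i → *-distribˡ-sum (f i) g)

m≤n⇒2mn≤m²+n² : ∀ {m n} → m ≤ n → 2 * (m * n) ≤ m * m + n * n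
m≤n⇒2mn≤m²+n² {m} m≤n with m≤n⇒∃[o]m+o≡n m≤n
... | d , refl = subst (2 * (m * (m + d)) ≤_) (square-gap m d) (m≤m+n _ (d * d))
  where
  square-gap : ∀ m d → 2 * (m * (m + d)) + d * d ≡ m * m + (m + d) * (m + d)
  square-gap = solve-∀

2mn≤m²+n² : ∀ m n → 2 * (m * n) ≤ m * m + n * n
2mn≤m²+n² m n with ≤-total m n
... | inj₁ m≤n = m≤n⇒2mn≤m²+n² m≤n
... | inj₂ n≤m = subst₂ _≤_ (cong (2 *_) (*-comm n m)) (+-comm (n * n) (m * m)) (m≤n⇒2mn≤m²+n² n≤m)

∑-cauchy-schwarz : ∀ {k} (f : Fin k → ℕ) → sum f * sum f ≤ k * ∑[ i < k ] (f i * f i)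
∑-cauchy-schwarz {k} f = *-cancelˡ-≤ 2 (begin
  2 * (sum f * sum f)
    ≡⟨ cong (2 *_) (∑*∑ f f) ⟩
  2 * ∑[ i < k ] ∑[ j < k ] (f i * f j)
    ≡⟨ *-distribˡ-sum 2 (λ i → ∑[ j < k ] (f i * f j)) ⟩
  ∑[ i < k ] (2 * ∑[ j < k ] (f i * f j))
    ≡⟨ sum-cong-≗ (λ i → *-distribˡ-sum 2 (λ j → f i * f j)) ⟩
  ∑[ i < k ] ∑[ j < k ] (2 * (f i * f j))
    ≤⟨ ∑-mono-≤ (λ i → ∑-mono-≤ (λ j → 2mn≤m²+n² (f i) (f j))) ⟩
  ∑[ i < k ] ∑[ j < k ] (f i * f i + f j * f j)
    ≡⟨ sum-cong-≗ (λ i → ∑-distrib-+ (λ _ → f i * f i) (λ j → f j * f j)) ⟩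
  ∑[ i < k ] (∑[ j < k ] (f i * f i) + S)
    ≡⟨ ∑-distrib-+ (λ i → ∑[ j < k ] (f i * f i)) (λ _ → S) ⟩
  ∑[ i < k ] ∑[ j < k ] (f i * f i) + ∑[ i < k ] S
    ≡⟨ cong₂ _+_ (sum-cong-≗ (λ i → ∑-const k (f i * f i))) (∑-const k S) ⟩
  ∑[ i < k ] (k * (f i * f i)) + k * S
    ≡⟨ cong (_+ k * S) (*-distribˡ-sum k (λ i → f i * f i)) ⟨
  k * S + k * S
    ≡⟨ double (k * S) ⟩
  2 * (k * S) ∎)
  where
  open ≤-Reasoning
  S = ∑[ i < k ] (f i * f i)
  double : ∀ x → x + x ≡ 2 * x
  double = solve-∀

∑∑-symmetric : ∀ {n} (h : Fin n → Fin n → ℕ) → (∀ j k → h j k ≡ h k j) →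
  ∑[ j < n ] ∑[ k < n ] h j k ≡ ∑[ j < n ] h j j + 2 * ∑[ j < n ] ∑[ k < n ] (𝟙 (does (j <? k)) * h j k)
∑∑-symmetric {zero}  h h-sym = refl
∑∑-symmetric {suc n} h h-sym = begin
  (h zero zero + R) + ∑[ j < n ] (h (suc j) zero + ∑[ k < n ] h′ j k)
    ≡⟨ cong (h zero zero + R +_) (∑-distrib-+ (λ j → h (suc j) zero) (λ j → ∑[ k < n ] h′ j k)) ⟩
  (h zero zero + R) + (∑[ j < n ] h (suc j) zero + ∑[ j < n ] ∑[ k < n ] h′ j k)
    ≡⟨ cong₂ (λ a b → h zero zero + R + (a + b)) (sum-cong-≗ (λ j → h-sym (suc j) zero))
             (∑∑-symmetric h′ (λ j k → h-sym (suc j) (suc k))) ⟩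
  (h zero zero + R) + (R + (D′ + 2 * P′))
    ≡⟨ regroup (h zero zero) R D′ P′ ⟩
  (h zero zero + D′) + 2 * (R + P′)
    ≡⟨ cong (λ r → h zero zero + D′ + 2 * (r + P′)) (sum-cong-≗ (λ k → *-identityˡ (h zero (suc k)))) ⟨
  (h zero zero + D′) + 2 * (∑[ k < n ] (1 * h zero (suc k)) + P′) ∎
  where
  open ≡-Reasoning
  h′ : Fin n → Fin n → ℕ
  h′ j k = h (suc j) (suc k)
  R  = ∑[ k < n ] h zero (suc k)
  D′ = ∑[ j < n ] h′ j j
  P′ = ∑[ j < n ] ∑[ k < n ] (𝟙 (does (j <? k)) * h′ j k)
  regroup : ∀ a r d p → (a + r) + (r + (d + 2 * p)) ≡ (a + d) + 2 * (r + p)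
  regroup = solve-∀

count : ∀ {n} → (Fin n → Bool) → ℕ
count {n} A = ∑[ j < n ] 𝟙 (A j)

module ColourClasses {n m : ℕ} (A : Fin n → Bool) (c : Fin n → Fin m) where

  inClass : Fin n → Fin m → ℕ
  inClass j t = 𝟙 (A j ∧ does (c j ≟ t))

  classSize : Fin m → ℕ
  classSize t = ∑[ j < n ] inClass j t

  sameClass : Fin n → Fin n → ℕ
  sameClass j k = 𝟙 (A j ∧ A k ∧ does (c j ≟ c k))

  monochromaticPairs : ℕ
  monochromaticPairs = ∑[ j < n ] ∑[ k < n ] (𝟙 (does (j <? k)) * sameClass j k)

  ∑-classSize : ∑[ t < m ] classSize t ≡ count A
  ∑-classSize = trans (∑-comm (λ t j → inClass j t)) (sum-cong-≗ ∑-membership)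
    where
    ∑-membership : ∀ j → ∑[ t < m ] inClass j t ≡ 𝟙 (A j)
    ∑-membership j with A j
    ... | false = sum-replicate-zero m
    ... | true  = trans (sum-cong-≗ (λ t → sym (*-identityʳ (𝟙 (does (c j ≟ t)))))) (∑-δ (c j) (λ _ → 1))

  ∑-sameClass : ∀ j k →
    ∑[ t < m ] (inClass j t * inClass k t) ≡ sameClass j k
  ∑-sameClass j k with A j | A k
  ... | false | _     = sum-replicate-zero m
  ... | true  | false = trans (sum-cong-≗ (λ t → *-zeroʳ (𝟙 (does (c j ≟ t))))) (sum-replicate-zero m)
  ... | true  | true  = trans (sum-cong-≗ (λ t → *-comm (𝟙 (does (c j ≟ t))) (𝟙 (does (c k ≟ t)))))
                              (∑-δ (c k) (λ t → 𝟙 (does (c j ≟ t))))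

  sameClass-sym : ∀ j k → sameClass j k ≡ sameClass k j
  sameClass-sym j k = begin
    sameClass j k                            ≡⟨ ∑-sameClass j k ⟨
    ∑[ t < m ] (inClass j t * inClass k t)  ≡⟨ sum-cong-≗ (λ t → *-comm (inClass j t) (inClass k t)) ⟩
    ∑[ t < m ] (inClass k t * inClass j t)  ≡⟨ ∑-sameClass k j ⟩
    sameClass k j                            ∎
    where open ≡-Reasoning

  sameClass-refl : ∀ j → sameClass j j ≡ 𝟙 (A j)
  sameClass-refl j with A j
  ... | false = refl
  ... | true  = cong 𝟙 (dec-true (c j ≟ c j) refl)

  ∑-classSize² : ∑[ t < m ] (classSize t * classSize t) ≡ count A + 2 * monochromaticPairs
  ∑-classSize² = begin
    ∑[ t < m ] (classSize t * classSize t)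
      ≡⟨ sum-cong-≗ (λ t → ∑*∑ (λ j → inClass j t) (λ k → inClass k t)) ⟩
    ∑[ t < m ] ∑[ j < n ] ∑[ k < n ] (inClass j t * inClass k t)
      ≡⟨ ∑-comm (λ t j → ∑[ k < n ] (inClass j t * inClass k t)) ⟩
    ∑[ j < n ] ∑[ t < m ] ∑[ k < n ] (inClass j t * inClass k t)
      ≡⟨ sum-cong-≗ (λ j → ∑-comm (λ t k → inClass j t * inClass k t)) ⟩
    ∑[ j < n ] ∑[ k < n ] ∑[ t < m ] (inClass j t * inClass k t)
      ≡⟨ sum-cong-≗ (λ j → sum-cong-≗ (∑-sameClass j)) ⟩
    ∑[ j < n ] ∑[ k < n ] sameClass j k
      ≡⟨ ∑∑-symmetric sameClass sameClass-sym ⟩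
    ∑[ j < n ] sameClass j j + 2 * monochromaticPairs
      ≡⟨ cong (_+ 2 * monochromaticPairs) (sum-cong-≗ sameClass-refl) ⟩
    count A + 2 * monochromaticPairs ∎
    where open ≡-Reasoning

  count²≤m*[count+2*pairs] : count A * count A ≤ m * (count A + 2 * monochromaticPairs)
  count²≤m*[count+2*pairs] = subst₂ (λ s s² → s * s ≤ m * s²) ∑-classSize ∑-classSize² (∑-cauchy-schwarz classSize)

later : ∀ {n} → Fin n → Fin n → Bool
later i j = does (i <? j)

count-later-zero : ∀ n → count (later {suc n} zero) ≡ n
count-later-zero n = trans (∑-const n 1) (*-identityʳ n)

∑-count-later : ∀ n → 2 * ∑[ i < n ] count (later i) + n ≡ n * n
∑-count-later zero    = refl
∑-count-later (suc n) = begin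
  2 * (count (later {suc n} zero) + S) + suc n ≡⟨ cong (λ a → 2 * (a + S) + suc n) (count-later-zero n) ⟩
  2 * (n + S) + suc n                          ≡⟨ regroup n S ⟩
  (2 * S + n) + 2 * n + 1                      ≡⟨ cong (λ s → s + 2 * n + 1) (∑-count-later n) ⟩
  n * n + 2 * n + 1                            ≡⟨ square n ⟩
  suc n * suc n                                ∎
  where
  open ≡-Reasoning
  S = ∑[ i < n ] count (later i)
  regroup : ∀ n S → 2 * (n + S) + suc n ≡ (2 * S + n) + 2 * n + 1
  regroup = solve-∀
  square : ∀ n → n * n + 2 * n + 1 ≡ suc n * suc n
  square = solve-∀

∑-count-later² : ∀ n →
  6 * ∑[ i < n ] (count (later i) * count (later i)) + 3 * (n * n) ≡ 2 * (n * n * n) + n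
∑-count-later² zero    = refl
∑-count-later² (suc n) = begin
  6 * (count (later {suc n} zero) * count (later {suc n} zero) + S) + 3 * (suc n * suc n)
    ≡⟨ cong (λ a → 6 * (a * a + S) + 3 * (suc n * suc n)) (count-later-zero n) ⟩
  6 * (n * n + S) + 3 * (suc n * suc n)
    ≡⟨ regroup n S ⟩
  (6 * S + 3 * (n * n)) + 6 * (n * n) + 6 * n + 3
    ≡⟨ cong (λ s → s + 6 * (n * n) + 6 * n + 3) (∑-count-later² n) ⟩
  2 * (n * n * n) + n + 6 * (n * n) + 6 * n + 3
    ≡⟨ cube n ⟩
  2 * (suc n * suc n * suc n) + suc n ∎
  where
  open ≡-Reasoning
  S = ∑[ i < n ] (count (later i) * count (later i))
  regroup : ∀ n S → 6 * (n * n + S) + 3 * (suc n * suc n) ≡ (6 * S + 3 * (n * n)) + 6 * (n * n) + 6 * n + 3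
  regroup = solve-∀
  cube : ∀ n → 2 * (n * n * n) + n + 6 * (n * n) + 6 * n + 3 ≡ 2 * ((1 + n) * (1 + n) * (1 + n)) + (1 + n)
  cube = solve-∀

cube≡^3 : ∀ n → n * n * n ≡ n ^ 3
cube≡^3 n = trans (*-assoc n n n) (cong (λ m → n * (n * m)) (sym (*-identityʳ n)))

cubic-bound : ∀ {n q T X Y} → 8 ≤ n → 4 * q ≤ n → 1 ≤ q →
  6 * X + 3 * (n * n) ≡ 2 * (n * n * n) + n → 2 * Y + n ≡ n * n →
  X ≤ suc q * (Y + 2 * T) → n ^ 3 ≤ 48 * (q * T)
cubic-bound {n} {q} {T} {X} {Y} 8≤n 4q≤n 1≤q ∑a² ∑a X≤ =
  *-cancelˡ-≤ 2 (+-cancelʳ-≤ (6 * n³) (2 * n ^ 3) (2 * (48 * (q * T))) (begin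
    2 * n ^ 3 + 6 * n³
      ≡⟨ cong (λ m → 2 * m + 6 * n³) (cube≡^3 n) ⟨
    2 * n³ + 6 * n³
      ≡⟨ four-times n³ ⟩
    4 * (2 * n³)
      ≤⟨ *-monoʳ-≤ 4 (m≤m+n (2 * n³) n) ⟩
    4 * (2 * n³ + n)
      ≡⟨ cong (4 *_) ∑a² ⟨
    4 * (6 * X + 3 * n²)
      ≤⟨ *-monoʳ-≤ 4 (+-monoˡ-≤ (3 * n²) (*-monoʳ-≤ 6 X≤)) ⟩
    4 * (6 * (suc q * (Y + 2 * T)) + 3 * n²)
      ≡⟨ expand q Y T n² ⟩
    12 * suc q * (2 * Y) + 12 * n² + 48 * (suc q * T)
      ≤⟨ +-monoˡ-≤ _ (+-monoˡ-≤ _ (*-monoʳ-≤ (12 * suc q) 2Y≤n²)) ⟩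
    12 * suc q * n² + 12 * n² + 48 * (suc q * T)
      ≡⟨ regroup q n² T ⟩
    3 * (4 * q) * n² + 3 * 8 * n² + 48 * (suc q * T)
      ≤⟨ +-mono-≤ (+-mono-≤ (*-monoˡ-≤ n² (*-monoʳ-≤ 3 4q≤n)) (*-monoˡ-≤ n² (*-monoʳ-≤ 3 8≤n)))
                  (*-monoʳ-≤ 48 (*-monoˡ-≤ T q+1≤2q)) ⟩
    3 * n * n² + 3 * n * n² + 48 * ((q + q) * T)
      ≡⟨ collect n q T ⟩
    2 * (48 * (q * T)) + 6 * n³ ∎))
  where
  open ≤-Reasoning
  n² = n * n
  n³ = n * n * n
  2Y≤n² : 2 * Y ≤ n²
  2Y≤n² = subst (2 * Y ≤_) ∑a (m≤m+n (2 * Y) n)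
  q+1≤2q : suc q ≤ q + q
  q+1≤2q = subst (_≤ q + q) (+-comm q 1) (+-monoʳ-≤ q 1≤q)
  four-times : ∀ x → 2 * x + 6 * x ≡ 4 * (2 * x)
  four-times = solve-∀
  expand : ∀ q Y T s → 4 * (6 * (suc q * (Y + 2 * T)) + 3 * s) ≡ 12 * suc q * (2 * Y) + 12 * s + 48 * (suc q * T)
  expand = solve-∀
  regroup : ∀ q s T → 12 * suc q * s + 12 * s + 48 * (suc q * T) ≡ 3 * (4 * q) * s + 3 * 8 * s + 48 * (suc q * T)
  regroup = solve-∀
  collect : ∀ n q T → 3 * n * (n * n) + 3 * n * (n * n) + 48 * ((q + q) * T) ≡ 2 * (48 * (q * T)) + 6 * (n * n * n)
  collect = solve-∀

countFin³≡∑³ : ∀ {n} {f g : Fin n → Fin n → Fin n → ℕ} → (∀ i j k → f i j k ≡ g i j k) →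
  countFin (λ i → countFin (λ j → countFin (λ k → f i j k))) ≡ ∑[ i < n ] ∑[ j < n ] ∑[ k < n ] g i j k
countFin³≡∑³ {n} {f} {g} f≗g =
  trans (countFin≡sum (λ i → countFin (λ j → countFin (λ k → f i j k)))) (sum-cong-≗ λ i →
  trans (countFin≡sum (λ j → countFin (λ k → f i j k))) (sum-cong-≗ λ j →
  trans (countFin≡sum (λ k → f i j k)) (sum-cong-≗ (f≗g i j))))

module CollinearTriples {c ℓ : Level} (F : FiniteField c ℓ) (P : List (FiniteField.Point F))
  (dec : ∀ p p' p'' → Dec (FiniteField.Collinear F p p' p'')) where

  open FiniteField F using (order)
  open Directions F using (direction; sameDirection⇒collinear)

  N : ℕ
  N = length P

  directionFrom : Fin N → Fin N → Fin (suc order)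
  directionFrom i j = direction (lookup P i) (lookup P j)

  open module Pencil (i : Fin N) = ColourClasses (later i) (directionFrom i)
    using (sameClass; monochromaticPairs; count²≤m*[count+2*pairs])

  isTriple : Fin N → Fin N → Fin N → Bool
  isTriple i j k = does (i <? j) ∧ does (j <? k) ∧ does (dec (lookup P i) (lookup P j) (lookup P k))

  mutual
    collinearTriples≡∑ : collinearTriples F P dec ≡ ∑[ i < N ] ∑[ j < N ] ∑[ k < N ] 𝟙 (isTriple i j k)
    collinearTriples≡∑ = countFin³≡∑³ λ i j k → trans (triple-indicator i j k)
      (cong 𝟙 (cong₂ _∧_ (isYes≗does (i <? j))
              (cong₂ _∧_ (isYes≗does (j <? k)) (isYes≗does (dec (lookup P i) (lookup P j) (lookup P k))))))

    -- The left-hand side is the summand of collinearTriples, which is local to its definition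
    -- and so can only be named by unification.  The right-hand side uses isYes rather than does:
    -- does (i <? j) reduces to a comparison of toℕ i and toℕ j in which i <? j no longer occurs,
    -- so `with i <? j` would leave it untouched.
    triple-indicator : ∀ i j k →
      _ ≡ 𝟙 (isYes (i <? j) ∧ isYes (j <? k) ∧ isYes (dec (lookup P i) (lookup P j) (lookup P k)))
    triple-indicator i j k with i <? j | j <? k | dec (lookup P i) (lookup P j) (lookup P k)
    ... | yes _ | yes _ | yes _ = refl
    ... | yes _ | yes _ | no  _ = refl
    ... | yes _ | no  _ | _     = refl
    ... | no  _ | _     | _     = refl

  pair⇒triple : ∀ i j k → 𝟙 (does (j <? k)) * sameClass i j k ≤ 𝟙 (isTriple i j k)
  pair⇒triple i j k
    with does (j <? k) | does (i <? j) | does (i <? k) | directionFrom i j ≟ directionFrom i k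
       | dec (lookup P i) (lookup P j) (lookup P k)
  ... | false | _     | _     | _        | _        = z≤n
  ... | true  | false | _     | _        | _        = z≤n
  ... | true  | true  | false | _        | _        = z≤n
  ... | true  | true  | true  | no  _    | _        = z≤n
  ... | true  | true  | true  | yes _    | yes _    = ≤-refl
  ... | true  | true  | true  | yes same | no ¬coll = contradiction (sameDirection⇒collinear _ _ _ same) ¬coll

  ∑-monochromaticPairs≤collinearTriples : ∑[ i < N ] monochromaticPairs i ≤ collinearTriples F P dec
  ∑-monochromaticPairs≤collinearTriples = begin
    ∑[ i < N ] monochromaticPairs i
      ≤⟨ ∑-mono-≤ (λ i → ∑-mono-≤ (λ j → ∑-mono-≤ (pair⇒triple i j))) ⟩
    ∑[ i < N ] ∑[ j < N ] ∑[ k < N ] 𝟙 (isTriple i j k)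
      ≡⟨ collinearTriples≡∑ ⟨
    collinearTriples F P dec ∎
    where open ≤-Reasoning

  ∑-count-later²≤ : ∑[ i < N ] (count (later i) * count (later i)) ≤
                    suc order * (∑[ i < N ] count (later i) + 2 * collinearTriples F P dec)
  ∑-count-later²≤ = begin
    ∑[ i < N ] (count (later i) * count (later i))
      ≤⟨ ∑-mono-≤ count²≤m*[count+2*pairs] ⟩
    ∑[ i < N ] (suc order * (count (later i) + 2 * monochromaticPairs i))
      ≡⟨ *-distribˡ-sum (suc order) (λ i → count (later i) + 2 * monochromaticPairs i) ⟨
    suc order * ∑[ i < N ] (count (later i) + 2 * monochromaticPairs i)
      ≡⟨ cong (suc order *_) (∑-distrib-+ (λ i → count (later i)) (λ i → 2 * monochromaticPairs i)) ⟩
    suc order * (∑[ i < N ] count (later i) + ∑[ i < N ] (2 * monochromaticPairs i))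
      ≡⟨ cong (λ s → suc order * (∑[ i < N ] count (later i) + s)) (*-distribˡ-sum 2 monochromaticPairs) ⟨
    suc order * (∑[ i < N ] count (later i) + 2 * ∑[ i < N ] monochromaticPairs i)
      ≤⟨ *-monoʳ-≤ (suc order)
           (+-monoʳ-≤ (∑[ i < N ] count (later i)) (*-monoʳ-≤ 2 ∑-monochromaticPairs≤collinearTriples)) ⟩
    suc order * (∑[ i < N ] count (later i) + 2 * collinearTriples F P dec) ∎
    where open ≤-Reasoning

2≤order : ∀ {c ℓ} (F : FiniteField c ℓ) → 2 ≤ FiniteField.order F
2≤order F = two-elements (complete 0#) (complete 1#)
  where
  open FiniteField F using (_≈_; 0#; 1#; complete; isField) renaming (trans to ≈-trans; sym to ≈-sym)
  open IsFieldCR isField using (1≉0)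
  two-elements : ∀ {xs} → Any (0# ≈_) xs → Any (1# ≈_) xs → 2 ≤ length xs
  two-elements {_ ∷ _ ∷ _} _          _          = s≤s (s≤s z≤n)
  two-elements {_ ∷ []}    (here 0≈x) (here 1≈x) = contradiction (≈-trans 1≈x (≈-sym 0≈x)) 1≉0

lemma1 : Σ ℕ λ K → (1 ≤ K) ×
           ((F : FiniteField 0ℓ 0ℓ) → (P : List (FiniteField.Point F)) →
            FiniteField.DistinctPoints F P →
            4 * FiniteField.order F ≤ length P →
            (dec : ∀ p p' p'' → Dec (FiniteField.Collinear F p p' p'')) →
            length P ^ 3 ≤ K * (FiniteField.order F * collinearTriples F P dec))
lemma1 = 48 , s≤s z≤n , λ F P _ 4q≤N dec →
  let open CollinearTriples F P dec
      2≤q = 2≤order F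
  in cubic-bound {Y = ∑[ i < N ] count (later i)}
                 (≤-trans (*-monoʳ-≤ 4 2≤q) 4q≤N) 4q≤N (≤-trans (s≤s z≤n) 2≤q)
                 (∑-count-later² N) (∑-count-later N) ∑-count-later²≤
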